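{- Let $V$ and $W$ be finite sets, $G\leq \mathrm{Sym}(V)$ and $H\leq \mathrm{Sym}(W)$. Let $G\times H$ act on $V\times W$ by the external direct product action $(g,h)\colon (v,w)\mapsto (g(v),h(w))$. Then $$\overline{\Gamma_{G\times H}}\cong \overline{\Gamma_G}\boxtimes \overline{\Gamma_H}.$$
   Context: For a permutation group $K$ on a finite set, an element is a derangement if it fixes no point. The derangement graph $\Gamma_K$ is the graph with vertex set $K$ in which distinct $g,h$ are adjacent iff $gh^{ -1}$ is a derangement. $\overline{X}$ denotes the usual complement of a simple graph $X$ (no loops). The strong product $X\boxtimes Y$ of graphs has vertex set $V(X)\times V(Y)$, with $(x_1,y_1)$ adjacent to $(x_2,y_2)$ iff either ($x_1=x_2$ and $y_1y_2\in E(Y)$), or ($y_1=y_2$ and $x_1x_2\in E(X)$), or ($x_1x_2\in E(X)$ and $y_1y_2\in E(Y)$). -}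

module Defs where

open import Level using (Level; _⊔_; suc)
open import Data.Product using (Σ; _×_; _,_; proj₁; proj₂)
open import Data.Sum using (_⊎_)
open import Relation.Nullary using (¬_)
open import Relation.Binary.PropositionalEquality using (_≡_; _≢_; cong; cong₂)
open import Function.Bundles using (_↔_; Inverse)

-- A permutation group on a set X: a group (given by its multiplication,
-- identity and inverse) acting on X, with the action faithful, so that the
-- group is (isomorphic to) a subgroup of Sym(X) via g ↦ act g.
-- The group axioms follow from the action laws together with faithfulness.
record PermGroup (X : Set) : Set₁ where
  field
    Carrier : Set
    _∙_     : Carrier → Carrier → Carrier
    e       : Carrier
    _⁻¹     : Carrier → Carrier
    act     : Carrier → X → X
    act-∙   : ∀ g h x → act (g ∙ h) x ≡ act g (act h x)
    act-e   : ∀ x → act e x ≡ x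
    act-⁻¹  : ∀ g x → act (g ⁻¹) (act g x) ≡ x
    faithful : ∀ g h → (∀ x → act g x ≡ act h x) → g ≡ h

record Graph : Set₁ where
  field
    Vertex : Set
    Adj    : Vertex → Vertex → Set

open Graph public

complement : Graph → Graph
complement Γ = record
  { Vertex = Vertex Γ
  ; Adj    = λ x y → x ≢ y × ¬ Adj Γ x y }

_⊠_ : Graph → Graph → Graph
X ⊠ Y = record
  { Vertex = Vertex X × Vertex Y
  ; Adj    = λ p q →
      (proj₁ p ≡ proj₁ q × Adj Y (proj₂ p) (proj₂ q))
      ⊎ (proj₂ p ≡ proj₂ q × Adj X (proj₁ p) (proj₁ q))
      ⊎ (Adj X (proj₁ p) (proj₁ q) × Adj Y (proj₂ p) (proj₂ q)) }

record _≅_ (A B : Graph) : Set where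
  field
    bij   : Vertex A ↔ Vertex B
    adj⇒  : ∀ x y → Adj A x y → Adj B (Inverse.to bij x) (Inverse.to bij y)
    adj⇐  : ∀ x y → Adj B (Inverse.to bij x) (Inverse.to bij y) → Adj A x y

module _ {X : Set} (K : PermGroup X) where
  open PermGroup K

  IsDerangement : Carrier → Set
  IsDerangement k = ∀ x → act k x ≢ x

  derangementGraph : Graph
  derangementGraph = record
    { Vertex = Carrier
    ; Adj    = λ g h → g ≢ h × IsDerangement (g ∙ (h ⁻¹)) }

-- External direct product G × H acting on V × W by (g,h)(v,w) = (g v, h w).
-- (Faithfulness of this action requires V and W nonempty.)
module _ {V W : Set} (G : PermGroup V) (H : PermGroup W) where
  private
    module G = PermGroup G
    module H = PermGroup H

  directProduct : V → W → PermGroup (V × W)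
  directProduct v₀ w₀ = record
    { Carrier = G.Carrier × H.Carrier
    ; _∙_ = λ a b → (proj₁ a G.∙ proj₁ b) , (proj₂ a H.∙ proj₂ b)
    ; e = G.e , H.e
    ; _⁻¹ = λ a → (proj₁ a G.⁻¹) , (proj₂ a H.⁻¹)
    ; act = λ a p → G.act (proj₁ a) (proj₁ p) , H.act (proj₂ a) (proj₂ p)
    ; act-∙ = λ a b p → cong₂ _,_ (G.act-∙ (proj₁ a) (proj₁ b) (proj₁ p))
                                  (H.act-∙ (proj₂ a) (proj₂ b) (proj₂ p))
    ; act-e = λ p → cong₂ _,_ (G.act-e (proj₁ p)) (H.act-e (proj₂ p))
    ; act-⁻¹ = λ a p → cong₂ _,_ (G.act-⁻¹ (proj₁ a) (proj₁ p))
                                  (H.act-⁻¹ (proj₂ a) (proj₂ p))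
    ; faithful = λ a b eq → cong₂ _,_
        (G.faithful (proj₁ a) (proj₁ b) (λ v → cong proj₁ (eq (v , w₀))))
        (H.faithful (proj₂ a) (proj₂ b) (λ w → cong proj₂ (eq (v₀ , w))))
    }

-- In any permutation group on a nonempty set, g ∙ g⁻¹ fixes every point, so in
-- the complement of a derangement graph "g = h or g ~ h" says exactly that
-- g ∙ h⁻¹ is not a derangement. A pair (a , b) acting on V × W fixes a point iff
-- a and b both do, so "p = q or p ~ q" in the complement for G × H splits into
-- the same condition in each factor, which is the closed-neighbourhood
-- description of the strong product.
module Submission where

open import Defs
open import Data.Nat using (ℕ; suc)
open import Data.Fin using (Fin; zero)
open import Data.Fin.Properties using (all?; _≟_)
open import Data.Product using (_×_; _,_; proj₁; proj₂)
open import Data.Empty using (⊥-elim)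
open import Data.Sum using (inj₁; inj₂)
open import Relation.Nullary using (¬_; Dec; yes; no)
open import Relation.Binary.PropositionalEquality
  using (_≡_; _≢_; refl; sym; trans; cong; cong₂)
open import Relation.Binary.Construct.Closure.Reflexive using (ReflClosure; refl; [_])
open import Function.Properties.Inverse using (↔-refl)

Adj⁼ : (Γ : Graph) → Vertex Γ → Vertex Γ → Set
Adj⁼ Γ = ReflClosure (Adj Γ)

module _ (X Y : Graph) where

  ⊠-adj⁺ : ∀ {p q} → p ≢ q → Adj⁼ X (proj₁ p) (proj₁ q) → Adj⁼ Y (proj₂ p) (proj₂ q)
         → Adj (X ⊠ Y) p q
  ⊠-adj⁺ p≢q refl  refl  = ⊥-elim (p≢q refl)
  ⊠-adj⁺ p≢q refl  [ y ] = inj₁ (refl , y)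
  ⊠-adj⁺ p≢q [ x ] refl  = inj₂ (inj₁ (refl , x))
  ⊠-adj⁺ p≢q [ x ] [ y ] = inj₂ (inj₂ (x , y))

  ⊠-adj⁻ : ∀ {p q} → Adj (X ⊠ Y) p q
         → Adj⁼ X (proj₁ p) (proj₁ q) × Adj⁼ Y (proj₂ p) (proj₂ q)
  ⊠-adj⁻ (inj₁ (refl , y))        = refl , [ y ]
  ⊠-adj⁻ (inj₂ (inj₁ (refl , x))) = [ x ] , refl
  ⊠-adj⁻ (inj₂ (inj₂ (x , y)))    = [ x ] , [ y ]

  ⊠-irreflexive : (∀ {x} → ¬ Adj X x x) → (∀ {y} → ¬ Adj Y y y)
                → ∀ {p q} → Adj (X ⊠ Y) p q → p ≢ q
  ⊠-irreflexive irrX irrY (inj₁ (_ , y))        refl = irrY y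
  ⊠-irreflexive irrX irrY (inj₂ (inj₁ (_ , x))) refl = irrX x
  ⊠-irreflexive irrX irrY (inj₂ (inj₂ (x , _))) refl = irrX x

module PermGroupProperties {X : Set} (K : PermGroup X) where
  open PermGroup K

  act-injective : ∀ g {x y} → act g x ≡ act g y → x ≡ y
  act-injective g {x} {y} eq =
    trans (sym (act-⁻¹ g x)) (trans (cong (act (g ⁻¹)) eq) (act-⁻¹ g y))

  act-⁻¹ʳ : ∀ g x → act g (act (g ⁻¹) x) ≡ x
  act-⁻¹ʳ g x = act-injective (g ⁻¹) (act-⁻¹ g (act (g ⁻¹) x))

  ∙⁻¹-¬derangement : X → ∀ g → ¬ IsDerangement K (g ∙ (g ⁻¹))
  ∙⁻¹-¬derangement x g der = der x (trans (act-∙ g (g ⁻¹) x) (act-⁻¹ʳ g x))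

  private
    Γ̅ : Graph
    Γ̅ = complement (derangementGraph K)

  Γ̅-adj⁺ : ∀ {g h} → g ≢ h → ¬ IsDerangement K (g ∙ (h ⁻¹)) → Adj Γ̅ g h
  Γ̅-adj⁺ g≢h ¬der = g≢h , λ adj → ¬der (proj₂ adj)

  Γ̅-adj⁻ : ∀ {g h} → Adj Γ̅ g h → ¬ IsDerangement K (g ∙ (h ⁻¹))
  Γ̅-adj⁻ (g≢h , ¬adj) der = ¬adj (g≢h , der)

  Γ̅-adj⁼⁺ : ∀ {g h} → Dec (g ≡ h) → ¬ IsDerangement K (g ∙ (h ⁻¹)) → Adj⁼ Γ̅ g h
  Γ̅-adj⁼⁺ (yes refl) _   = refl
  Γ̅-adj⁼⁺ (no g≢h)   ¬der = [ Γ̅-adj⁺ g≢h ¬der ]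

  Γ̅-adj⁼⁻ : X → ∀ {g h} → Adj⁼ Γ̅ g h → ¬ IsDerangement K (g ∙ (h ⁻¹))
  Γ̅-adj⁼⁻ x {g} refl = ∙⁻¹-¬derangement x g
  Γ̅-adj⁼⁻ x [ adj ]  = Γ̅-adj⁻ adj

-- Faithfulness reduces equality of group elements to a finite check on points.
carrier-≟ : ∀ {k} (K : PermGroup (Fin k)) (g h : PermGroup.Carrier K) → Dec (g ≡ h)
carrier-≟ K g h with all? (λ x → act g x ≟ act h x)
  where open PermGroup K
... | yes same = yes (PermGroup.faithful K g h same)
... | no ¬same = no λ { refl → ¬same λ _ → refl }

module _ {V W : Set} (G : PermGroup V) (H : PermGroup W) (v₀ : V) (w₀ : W) where
  private
    module G = PermGroup G
    module H = PermGroup H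

  directProduct-¬derangement⁻ : ∀ {a b} → ¬ IsDerangement (directProduct G H v₀ w₀) (a , b)
                              → ¬ IsDerangement G a × ¬ IsDerangement H b
  directProduct-¬derangement⁻ ¬der =
      (λ derG → ¬der λ p eq → derG (proj₁ p) (cong proj₁ eq))
    , (λ derH → ¬der λ p eq → derH (proj₂ p) (cong proj₂ eq))

  directProduct-¬derangement⁺ : ∀ {a b} → ¬ IsDerangement G a → ¬ IsDerangement H b
                              → ¬ IsDerangement (directProduct G H v₀ w₀) (a , b)
  directProduct-¬derangement⁺ ¬derG ¬derH der =
    ¬derG λ v fixv → ¬derH λ w fixw → der (v , w) (cong₂ _,_ fixv fixw)

theorem3p1 : (m n : ℕ) (G : PermGroup (Fin (suc m))) (H : PermGroup (Fin (suc n)))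
    → complement (derangementGraph (directProduct G H zero zero))
      ≅ (complement (derangementGraph G) ⊠ complement (derangementGraph H))
theorem3p1 m n G H = record { bij = ↔-refl ; adj⇒ = adj⇒ ; adj⇐ = adj⇐ }
  where
  module PG = PermGroupProperties G
  module PH = PermGroupProperties H
  module PP = PermGroupProperties (directProduct G H zero zero)
  Γ̅G = complement (derangementGraph G)
  Γ̅H = complement (derangementGraph H)

  adj⇒ : ∀ p q → Adj (complement (derangementGraph (directProduct G H zero zero))) p q
       → Adj (Γ̅G ⊠ Γ̅H) p q
  adj⇒ (g , h) (g′ , h′) adj =
    let ¬derG , ¬derH = directProduct-¬derangement⁻ G H zero zero (PP.Γ̅-adj⁻ adj)
    in ⊠-adj⁺ Γ̅G Γ̅H (proj₁ adj) (PG.Γ̅-adj⁼⁺ (carrier-≟ G g g′) ¬derG)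
                                 (PH.Γ̅-adj⁼⁺ (carrier-≟ H h h′) ¬derH)

  adj⇐ : ∀ p q → Adj (Γ̅G ⊠ Γ̅H) p q
       → Adj (complement (derangementGraph (directProduct G H zero zero))) p q
  adj⇐ p q adj =
    let adjG , adjH = ⊠-adj⁻ Γ̅G Γ̅H adj
    in PP.Γ̅-adj⁺ (⊠-irreflexive Γ̅G Γ̅H (λ a → proj₁ a refl) (λ a → proj₁ a refl) adj)
                 (directProduct-¬derangement⁺ G H zero zero (PG.Γ̅-adj⁼⁻ zero adjG)
                                                            (PH.Γ̅-adj⁼⁻ zero adjH))
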